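{- Let $\vec H$ be a DAG. Then there are graphs $H_1,H_2\in\mathcal G_{\vec H}$ such that $\mathrm{td}(H_1)\le \operatorname{dtd}(\vec H)\le \mathrm{td}(H_2)$.
   Context: For a DAG $\vec H$, a source is a vertex of indegree $0$, $S$ is the set of sources, and $R(s)$ is the set of vertices reachable from $s$ by a directed path. $\textsc{Bip}(\vec H)$ is the bipartite graph with parts $S$ and $V(\vec H)\setminus S$ and an edge $\{u,v\}$ ($u\in S$) iff $v\in R(u)$. $\mathcal G_{\vec H}$ is the family of all graphs obtained from $\textsc{Bip}(\vec H)$ by contracting, for each non-source vertex, exactly one of its incident edges (so the resulting graph has vertex set $S$); equivalently, for a choice of map $\pi$ assigning each non-source $v$ a source $\pi(v)$ with $v\in R(\pi(v))$, the graph on $S$ in which distinct $s,s'$ are adjacent iff some non-source $v$ has $\pi(v)=s$ and $v\in R(s')$ or $\pi(v)=s'$ and $v\in R(s)$. $\mathrm{td}$ denotes treedepth. A DAG elimination forest of $\vec H$ is defined recursively: if $\vec H$ is empty, the forest is empty; if $\vec H$ has exactly one source (and is connected), it is a single node; if the underlying undirected graph is disconnected, it is the union of DAG elimination forests of the components; otherwise it is a tree obtained by picking any source $s$, deleting $s$ and $R(s)$, making $s$ the root with subtrees the trees of a DAG elimination forest of the remaining DAG. $\operatorname{dtd}(\vec H)$ is the minimum over such forests of the maximum number of nodes on a root-to-leaf path. -}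

module Defs where

open import Data.Nat using (ℕ; zero; suc; _≤_)
open import Data.Fin using (Fin)
open import Data.Bool using (Bool; T)
open import Data.Product using (Σ; ∃; _×_; _,_)
open import Data.Sum using (_⊎_)
open import Data.Empty using (⊥)
open import Data.Unit using (⊤)
open import Relation.Nullary using (¬_)
open import Relation.Binary.PropositionalEquality using (_≡_)
open import Relation.Binary.Construct.Closure.ReflexiveTransitive using (Star)

record Digraph (n : ℕ) : Set where
  field
    arc : Fin n → Fin n → Bool

module _ {n : ℕ} (D : Digraph n) where
  open Digraph D

  Arc : Fin n → Fin n → Set
  Arc u v = T (arc u v)

  Reach : Fin n → Fin n → Set
  Reach = Star Arc

  IsDAG : Set
  IsDAG = ∀ u v → Arc u v → ¬ Reach v u

  Source : Fin n → Set
  Source v = ∀ u → ¬ Arc u v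

VSet : ℕ → Set₁
VSet n = Fin n → Set

-- Treedepth of an undirected graph G[X] (G given by a relation Adj on
-- Fin n, X the vertex set).  TdLE Adj X k  means: G[X] has an elimination
-- forest of height at most k, built by the usual recursion
--   empty graph            : empty forest,
--   splitting into two parts with no edges between them : union of forests,
--   choosing a root v      : v on top of a forest of G[X - v].

data TdLE {n : ℕ} (Adj : Fin n → Fin n → Set) : VSet n → ℕ → Set₁ where
  td-empty : ∀ {X k} → (∀ v → ¬ X v) → TdLE Adj X k
  td-split : ∀ {X k} (A B : VSet n) →
             (∀ v → X v → A v ⊎ B v) →
             (∀ v → A v → X v) → (∀ v → B v → X v) →
             (∀ v → A v → ¬ B v) →
             ∃ A → ∃ B →
             (∀ u v → A u → B v → ¬ Adj u v) →
             TdLE Adj A k → TdLE Adj B k → TdLE Adj X k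
  td-root  : ∀ {X k} (v : Fin n) → X v →
             TdLE Adj (λ u → X u × ¬ (u ≡ v)) k → TdLE Adj X (suc k)

IsTd : {n : ℕ} → (Fin n → Fin n → Set) → VSet n → ℕ → Set₁
IsTd Adj X t = TdLE Adj X t × (∀ k → TdLE Adj X k → t ≤ k)

module _ {n : ℕ} (D : Digraph n) where

  ArcIn : VSet n → Fin n → Fin n → Set
  ArcIn X u v = X u × X v × Arc D u v

  ReachIn : VSet n → Fin n → Fin n → Set
  ReachIn X = Star (ArcIn X)

  SourceIn : VSet n → Fin n → Set
  SourceIn X v = X v × (∀ u → ¬ ArcIn X u v)

  -- DtdLE X k : D[X] has a DAG elimination forest of height at most k.
  data DtdLE : VSet n → ℕ → Set₁ where
    dtd-empty : ∀ {X k} → (∀ v → ¬ X v) → DtdLE X k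
    dtd-split : ∀ {X k} (A B : VSet n) →
                (∀ v → X v → A v ⊎ B v) →
                (∀ v → A v → X v) → (∀ v → B v → X v) →
                (∀ v → A v → ¬ B v) →
                ∃ A → ∃ B →
                (∀ u v → A u → B v → ¬ Arc D u v × ¬ Arc D v u) →
                DtdLE A k → DtdLE B k → DtdLE X k
    -- pick a source s, delete s and R(s), s becomes the root
    -- (this also covers the single-source case: then R(s) is everything)
    dtd-root  : ∀ {X k} (s : Fin n) → SourceIn X s →
                DtdLE (λ u → X u × ¬ ReachIn X s u) k → DtdLE X (suc k)

  AllV : VSet n
  AllV _ = ⊤

  IsDtd : ℕ → Set₁
  IsDtd d = DtdLE AllV d × (∀ k → DtdLE AllV k → d ≤ k)

-- The family 𝒢_D: graphs on the set S of sources, determined by a choice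
-- map π assigning to every non-source v a source π v with v ∈ R(π v).

module _ {n : ℕ} (D : Digraph n) where

  ValidChoice : (Fin n → Fin n) → Set
  ValidChoice π = ∀ v → ¬ Source D v → Source D (π v) × Reach D (π v) v

  ContractAdj : (Fin n → Fin n) → Fin n → Fin n → Set
  ContractAdj π s s' =
    Source D s × Source D s' × ¬ (s ≡ s') ×
    (Σ (Fin n) λ v → ¬ Source D v ×
       ((π v ≡ s × Reach D s' v) ⊎ (π v ≡ s' × Reach D s v)))

  SourceSet : VSet n
  SourceSet = Source D

{-# OPTIONS --safe #-}
-- Both inequalities are witnessed by a single choice map π, for which td(G_π) = dtd(H).
--
-- A DAG elimination forest of height d yields π: a vertex deleted together with R(s) when
-- the node s is chosen is assigned to s.  The same forest, restricted to the sources, is an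
-- elimination forest of G_π: once s is chosen, the vertices assigned to the remaining
-- sources lie outside R(s), so the edges among those sources are those of the contraction
-- graph of the remaining DAG; and sources in different components reach disjoint sets, so
-- G_π has no edge between them.
--
-- Conversely, for any valid π an elimination forest of G_π gives a DAG elimination forest
-- of the same height.  Its root r is a source, and deleting R(r) removes exactly r from the
-- sources.  A split of G_π into two parts without edges between them splits H into the
-- vertices assigned to either part: an arc u → w with π u ≠ π w makes π u and π w adjacent.
--
-- Every vertex set occurring in these recursions is closed under predecessors, which keeps
-- paths and chosen sources inside it.  Finally, the minimum defining dtd exists because
-- having a DAG elimination forest of height at most k is decidable, by exhaustive search
-- over roots and over splits along a vertex subset.

module Submission where

open import Defs
open import Data.Nat using (ℕ; zero; suc; _≤_; z≤n; s≤s)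
open import Data.Nat.Properties using (≤-refl)
open import Data.Fin using (Fin; _≟_)
open import Data.Fin.Properties using (any?; all?)
open import Data.Fin.Subset using (Subset; _∈_; _⊂_)
open import Data.Fin.Subset.Properties using (anySubset?; _∈?_)
open import Data.Fin.Subset.Induction using (⊂-wellFounded; Acc; acc)
open import Data.Vec using (tabulate)
open import Data.Vec.Properties using (lookup∘tabulate; []=⇒lookup; lookup⇒[]=)
open import Data.Bool using (true; if_then_else_)
open import Data.Product using (Σ; ∃; _×_; _,_; proj₁; proj₂; uncurry)
open import Data.Sum using (_⊎_; inj₁; inj₂; [_,_]′)
import Data.Sum as Sum
import Data.Product as Product
open import Data.Empty using (⊥; ⊥-elim)
import Data.Empty.Polymorphic as Poly
open import Data.Unit using (tt)
open import Function using (_∘_; id; flip; const)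
open import Level using (0ℓ; _⊔_)
import Level
open import Relation.Nullary using (¬_; Dec; yes; no; does; contradiction)
import Relation.Nullary.Decidable as Dec
open import Relation.Nullary.Decidable using (_×-dec_; _⊎-dec_; _→-dec_; ¬?; T?; map′; dec-true; dec-false)
open import Relation.Unary using (Pred; Decidable; _∩_; _∖_; _⊆′_; _≐′_; Empty; Satisfiable)
open import Relation.Unary.Properties using (_∩?_; ∁?; ≐′-refl; ≐′-sym; ≐′-trans)
open import Relation.Binary.PropositionalEquality using (_≡_; refl; sym; trans; subst)
open import Relation.Binary.Construct.Closure.ReflexiveTransitive using (ε; _◅_; _◅◅_)
import Relation.Binary.Construct.Closure.ReflexiveTransitive as Star

Least : ∀ {ℓ} → Pred ℕ ℓ → ℕ → Set ℓ
Least P t = P t × (∀ k → P k → t ≤ k)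

least : ∀ {ℓ} {P : Pred ℕ ℓ} → Decidable P → ∀ {m} → P m → ∃ (Least P)
least P? {zero} p = 0 , p , λ _ _ → z≤n
least P? {suc m} p with P? 0
... | yes p₀ = 0 , p₀ , λ _ _ → z≤n
... | no ¬p₀ with least (P? ∘ suc) {m} p
...   | t , pt , minimal =
  suc t , pt , λ { zero p₀ → contradiction p₀ ¬p₀ ; (suc k) pk → s≤s (minimal k pk) }

-- Decidable vertex sets

module _ {n : ℕ} where

  toSubset : {X : VSet n} → Decidable X → Subset n
  toSubset X? = tabulate (does ∘ X?)

  toSubset⁺ : {X : VSet n} (X? : Decidable X) {v : Fin n} → X v → v ∈ toSubset X?
  toSubset⁺ X? {v} x = lookup⇒[]= v _ (trans (lookup∘tabulate _ v) (dec-true (X? v) x))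

  toSubset⁻ : {X : VSet n} (X? : Decidable X) {v : Fin n} → v ∈ toSubset X? → X v
  toSubset⁻ X? {v} v∈ =
    from-does (X? v) (trans (sym (lookup∘tabulate _ v)) ([]=⇒lookup v∈))
    where
    from-does : ∀ {A : Set} (a? : Dec A) → does a? ≡ true → A
    from-does (yes a) _ = a

  toSubset-⊂ : {X Y : VSet n} (X? : Decidable X) (Y? : Decidable Y) →
               Y ⊆′ X → ∀ {x} → X x → ¬ Y x → toSubset Y? ⊂ toSubset X?
  toSubset-⊂ X? Y? Y⊆X {x} x∈X x∉Y =
    (λ v∈Y → toSubset⁺ X? (Y⊆X _ (toSubset⁻ Y? v∈Y))) , x , toSubset⁺ X? x∈X , x∉Y ∘ toSubset⁻ Y?

  ForProperSubsets : ∀ {ℓ} → ({X : VSet n} → Decidable X → Set ℓ) →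
                     {X : VSet n} → Decidable X → Set (Level.suc 0ℓ ⊔ ℓ)
  ForProperSubsets P {X} X? = ∀ {Y} (Y? : Decidable Y) → Y ⊆′ X → ∀ {x} → X x → ¬ Y x → P Y?

  shrinking-induction : ∀ {ℓ} (P : {X : VSet n} → Decidable X → Set ℓ) →
                        (∀ {X} (X? : Decidable X) → ForProperSubsets P X? → P X?) →
                        ∀ {X} (X? : Decidable X) → P X?
  shrinking-induction P step X? = go X? (⊂-wellFounded _)
    where
    go : ∀ {X} (X? : Decidable X) → Acc _⊂_ (toSubset X?) → P X?
    go X? (acc rs) = step X? λ Y? Y⊆X x∈X x∉Y → go Y? (rs (toSubset-⊂ X? Y? Y⊆X x∈X x∉Y))

  part? : {X A B : VSet n} → Decidable X →
          (∀ v → X v → A v ⊎ B v) → A ⊆′ X → (∀ v → A v → ¬ B v) → Decidable A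
  part? X? part sa dis v with X? v
  ... | no ¬x = no (¬x ∘ sa v)
  ... | yes x with part v x
  ...   | inj₁ a = yes a
  ...   | inj₂ b = no λ a → dis v a b

  glue : ∀ {a} {A : Set a} {P : VSet n} → Decidable P → (Fin n → A) → (Fin n → A) → Fin n → A
  glue P? f g v = if does (P? v) then f v else g v

  module _ {a} {A : Set a} {P : VSet n} (P? : Decidable P) (f g : Fin n → A) where

    glue-in : ∀ {v} → P v → glue P? f g v ≡ f v
    glue-in {v} p rewrite dec-true (P? v) p = refl

    glue-out : ∀ {v} → ¬ P v → glue P? f g v ≡ g v
    glue-out {v} ¬p rewrite dec-false (P? v) ¬p = refl

-- Treedepth

module _ {n : ℕ} where

  tdLE-mono : ∀ {Adj Adj′ : Fin n → Fin n → Set} {X Y : VSet n} {k} →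
              X ≐′ Y → (∀ u v → Y u → Y v → Adj′ u v → Adj u v) →
              TdLE Adj X k → TdLE Adj′ Y k
  tdLE-mono (_ , Y⊆X) sub (td-empty e) = td-empty λ v → e v ∘ Y⊆X v
  tdLE-mono (X⊆Y , Y⊆X) sub (td-split A B part sa sb dis a b noe TA TB) =
    td-split A B (λ v → part v ∘ Y⊆X v) (λ v → X⊆Y v ∘ sa v) (λ v → X⊆Y v ∘ sb v) dis a b
      (λ u v au bv → noe u v au bv ∘ sub u v (X⊆Y u (sa u au)) (X⊆Y v (sb v bv)))
      (tdLE-mono ≐′-refl (λ u v au av → sub u v (X⊆Y u (sa u au)) (X⊆Y v (sa v av))) TA)
      (tdLE-mono ≐′-refl (λ u v bu bv → sub u v (X⊆Y u (sb u bu)) (X⊆Y v (sb v bv))) TB)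
  tdLE-mono (X⊆Y , Y⊆X) sub (td-root v xv T) =
    td-root v (X⊆Y v xv)
      (tdLE-mono ((λ u → Product.map₁ (X⊆Y u)) , (λ u → Product.map₁ (Y⊆X u)))
                 (λ u w yu yw → sub u w (proj₁ yu) (proj₁ yw)) T)

  tdLE-join : ∀ {Adj : Fin n → Fin n → Set} {X A B : VSet n} {k} → Decidable A → Decidable B →
              (∀ v → X v → A v ⊎ B v) → A ⊆′ X → B ⊆′ X → (∀ v → A v → ¬ B v) →
              (∀ u v → A u → B v → ¬ Adj u v) →
              TdLE Adj A k → TdLE Adj B k → TdLE Adj X k
  tdLE-join A? B? part sa sb dis noe TA TB with any? A? | any? B?
  ... | yes a | yes b = td-split _ _ part sa sb dis a b noe TA TB
  ... | no ¬a | _ =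
    tdLE-mono (sb , λ v x → [ (λ a → ⊥-elim (¬a (v , a))) , id ]′ (part v x)) (λ _ _ _ _ → id) TB
  ... | yes _ | no ¬b =
    tdLE-mono (sa , λ v x → [ id , (λ b → ⊥-elim (¬b (v , b))) ]′ (part v x)) (λ _ _ _ _ → id) TA

module _ {n : ℕ} (D : Digraph n) where

  Arc? : ∀ u v → Dec (Arc D u v)
  Arc? u v = T? (Digraph.arc D u v)

  Source? : Decidable (Source D)
  Source? v = all? λ u → ¬? (Arc? u v)

  ArcIn? : {X : VSet n} → Decidable X → ∀ u v → Dec (ArcIn D X u v)
  ArcIn? X? u v = X? u ×-dec X? v ×-dec Arc? u v

  SourceIn? : {X : VSet n} → Decidable X → Decidable (SourceIn D X)
  SourceIn? X? s = X? s ×-dec all? λ u → ¬? (ArcIn? X? u s)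

  AllV? : Decidable (AllV D)
  AllV? _ = yes tt

  -- Reachability and ancestral sets

  Rest : VSet n → Fin n → VSet n
  Rest X s = X ∖ ReachIn D X s

  Separated : VSet n → VSet n → Set
  Separated A B = ∀ u v → A u → B v → ¬ Arc D u v × ¬ Arc D v u

  Ancestral : VSet n → Set
  Ancestral X = ∀ u v → Arc D u v → X v → X u

  reachIn⇒reach : ∀ {X u v} → ReachIn D X u v → Reach D u v
  reachIn⇒reach = Star.map (proj₂ ∘ proj₂)

  reachIn-mono : ∀ {X Y} → X ⊆′ Y → ∀ {u v} → ReachIn D X u v → ReachIn D Y u v
  reachIn-mono X⊆Y = Star.map (Product.map (X⊆Y _) (Product.map₁ (X⊆Y _)))

  reach-source : ∀ {u s} → Source D s → Reach D u s → u ≡ s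
  reach-source src ε = refl
  reach-source src (a ◅ p) with refl ← reach-source src p = ⊥-elim (src _ a)

  source⇒sourceIn : ∀ {X s} → X s → Source D s → SourceIn D X s
  source⇒sourceIn xs src = xs , λ u a → src u (proj₂ (proj₂ a))

  rest-sources : ∀ {X s} → Rest X s ∩ Source D ≐′ (X ∩ Source D) ∖ (_≡ s)
  rest-sources =
      (λ { u ((xu , ¬s⇝u) , su) → (xu , su) , λ { refl → ¬s⇝u ε } })
    , (λ { u ((xu , su) , u≢s) → (xu , u≢s ∘ sym ∘ reach-source su ∘ reachIn⇒reach) , su })

  separated-sym : ∀ {A B} → Separated A B → Separated B A
  separated-sym sep u v bu av = Product.swap (sep v u av bu)

  ancestral-reach : ∀ {X u v} → Ancestral X → Reach D u v → X v → X u
  ancestral-reach anc ε xv = xv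
  ancestral-reach anc (a ◅ p) xv = anc _ _ a (ancestral-reach anc p xv)

  rest-ancestral : ∀ {X s} → Ancestral X → Ancestral (Rest X s)
  rest-ancestral anc u v a (xv , ¬s⇝v) =
    anc u v a xv , λ s⇝u → ¬s⇝v (s⇝u ◅◅ ((anc u v a xv , xv , a) ◅ ε))

  separated-ancestral : ∀ {X A B} → Ancestral X → (∀ v → X v → A v ⊎ B v) → A ⊆′ X →
                        Separated A B → Ancestral A
  separated-ancestral anc part sa sep u v a av with part u (anc u v a (sa v av))
  ... | inj₁ au = au
  ... | inj₂ bu = ⊥-elim (proj₂ (sep v u av bu) a)

  last-visit : ∀ {X} s {x t} → ReachIn D X x t →
               (¬ x ≡ s × ReachIn D (X ∖ (_≡ s)) x t) ⊎
               (s ≡ t ⊎ ∃ λ u → ArcIn D X s u × ReachIn D (X ∖ (_≡ s)) u t)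
  last-visit s {x} ε with x ≟ s
  ... | yes refl = inj₂ (inj₁ refl)
  ... | no x≢s = inj₁ (x≢s , ε)
  last-visit s {x} (a@(xx , xy , arc) ◅ p) with last-visit s p
  ... | inj₂ through-s = inj₂ through-s
  ... | inj₁ (y≢s , p′) with x ≟ s
  ...   | yes refl = inj₂ (inj₂ (_ , a , p′))
  ...   | no x≢s = inj₁ (x≢s , ((xx , x≢s) , (xy , y≢s) , arc) ◅ p′)

  first-step : ∀ {X s t} → ¬ s ≡ t → ReachIn D X s t →
               ∃ λ u → ArcIn D X s u × ReachIn D (X ∖ (_≡ s)) u t
  first-step {s = s} s≢t p with last-visit s p
  ... | inj₁ (s≢s , _) = contradiction refl s≢s
  ... | inj₂ (inj₁ s≡t) = contradiction s≡t s≢t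
  ... | inj₂ (inj₂ step) = step

  reachIn? : ∀ {X} → Decidable X → ∀ s t → Dec (ReachIn D X s t)
  reachIn? = shrinking-induction (λ {X} _ → ∀ s t → Dec (ReachIn D X s t)) step
    where
    step : ∀ {X} (X? : Decidable X) →
           ForProperSubsets (λ {Y} _ → ∀ s t → Dec (ReachIn D Y s t)) X? →
           ∀ s t → Dec (ReachIn D X s t)
    step X? rec s t with s ≟ t | X? s
    ... | yes refl | _ = yes ε
    ... | no s≢t | no s∉X = no λ { ε → s≢t refl ; (a ◅ _) → s∉X (proj₁ a) }
    ... | no s≢t | yes s∈X =
      map′ (λ (u , a , p) → a ◅ reachIn-mono (λ _ → proj₁) p) (first-step s≢t)
        (any? λ u → ArcIn? X? s u ×-dec
                    rec (X? ∩? ∁? (_≟ s)) (λ _ → proj₁) s∈X (λ s∈Y → proj₂ s∈Y refl) u t)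

  Rest? : ∀ {X} → Decidable X → ∀ s → Decidable (Rest X s)
  Rest? X? s = X? ∩? ∁? (reachIn? X? s)

  -- Deciding DAG treedepth

  dtdLE-resp-≐ : ∀ {X Y k} → X ≐′ Y → DtdLE D X k → DtdLE D Y k
  dtdLE-resp-≐ (_ , Y⊆X) (dtd-empty e) = dtd-empty λ v → e v ∘ Y⊆X v
  dtdLE-resp-≐ (X⊆Y , Y⊆X) (dtd-split A B part sa sb dis a b sep DA DB) =
    dtd-split A B (λ v → part v ∘ Y⊆X v) (λ v → X⊆Y v ∘ sa v) (λ v → X⊆Y v ∘ sb v)
      dis a b sep DA DB
  dtdLE-resp-≐ {X} {Y} (X⊆Y , Y⊆X) (dtd-root s (xs , no-arc) T) =
    dtd-root s (X⊆Y s xs , λ u (yu , ys , a) → no-arc u (Y⊆X u yu , Y⊆X s ys , a))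
      (dtdLE-resp-≐ ((λ u → Product.map (X⊆Y u) (_∘ reachIn-mono Y⊆X))
                   , (λ u → Product.map (Y⊆X u) (_∘ reachIn-mono X⊆Y))) T)

  Split : VSet n → ℕ → Subset n → Set₁
  Split X k q = Satisfiable (X ∩ (_∈ q)) × Satisfiable (X ∖ (_∈ q)) ×
                Separated (X ∩ (_∈ q)) (X ∖ (_∈ q)) ×
                DtdLE D (X ∩ (_∈ q)) k × DtdLE D (X ∖ (_∈ q)) k

  Rooted : VSet n → ℕ → Set₁
  Rooted X zero = Poly.⊥
  Rooted X (suc k) = ∃ λ s → SourceIn D X s × DtdLE D (Rest X s) k

  DtdView : VSet n → ℕ → Set₁
  DtdView X k = Empty X ⊎ ∃ (Split X k) ⊎ Rooted X k

  view⇒dtdLE : ∀ {X k} → DtdView X k → DtdLE D X k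
  view⇒dtdLE (inj₁ e) = dtd-empty e
  view⇒dtdLE (inj₂ (inj₁ (q , a , b , sep , DA , DB))) =
    dtd-split _ _ (λ v x → Sum.map (x ,_) (x ,_) (Dec.toSum (v ∈? q)))
      (λ _ → proj₁) (λ _ → proj₁) (λ v (_ , v∈q) (_ , v∉q) → v∉q v∈q) a b sep DA DB
  view⇒dtdLE {k = suc k} (inj₂ (inj₂ (s , src , T))) = dtd-root s src T

  dtdLE⇒view : ∀ {X k} → Decidable X → DtdLE D X k → DtdView X k
  dtdLE⇒view X? (dtd-empty e) = inj₁ e
  dtdLE⇒view {k = suc k} X? (dtd-root s src T) = inj₂ (inj₂ (s , src , T))
  dtdLE⇒view {X} X? (dtd-split A B part sa sb dis (a , aa) (b , bb) sep DA DB) =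
    inj₂ (inj₁ (q , (a , proj₁ A≐ a aa) , (b , proj₁ B≐ b bb) ,
                (λ u v au bv → sep u v (proj₂ A≐ u au) (proj₂ B≐ v bv)) ,
                dtdLE-resp-≐ A≐ DA , dtdLE-resp-≐ B≐ DB))
    where
    A? = part? X? part sa dis
    q = toSubset A?
    A≐ : A ≐′ X ∩ (_∈ q)
    A≐ = (λ v a → sa v a , toSubset⁺ A? a) , (λ v → toSubset⁻ A? ∘ proj₂)
    B≐ : B ≐′ X ∖ (_∈ q)
    B≐ = (λ v b → sb v b , λ v∈q → dis v (toSubset⁻ A? v∈q) b)
       , (λ v (x , v∉q) → [ (λ a → ⊥-elim (v∉q (toSubset⁺ A? a))) , id ]′ (part v x))

  separated? : ∀ {A B} → Decidable A → Decidable B → Dec (Separated A B)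
  separated? A? B? = all? λ u → all? λ v →
    A? u →-dec B? v →-dec ¬? (Arc? u v) ×-dec ¬? (Arc? v u)

  module _ {X : VSet n} (X? : Decidable X)
           (rec : ForProperSubsets (λ {Y} _ → ∀ k → Dec (DtdLE D Y k)) X?) where

    split? : ∀ k q → Dec (Split X k q)
    split? k q with any? (X? ∩? (_∈? q)) | any? (X? ∩? ∁? (_∈? q))
    ... | no ¬a | _ = no (¬a ∘ proj₁)
    ... | yes _ | no ¬b = no (¬b ∘ proj₁ ∘ proj₂)
    ... | yes a@(_ , xa , a∈q) | yes b@(_ , xb , b∉q) =
      map′ (λ rest → a , b , rest) (proj₂ ∘ proj₂)
        (separated? (X? ∩? (_∈? q)) (X? ∩? ∁? (_∈? q)) ×-dec
         rec (X? ∩? (_∈? q)) (λ _ → proj₁) xb (b∉q ∘ proj₂) k ×-dec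
         rec (X? ∩? ∁? (_∈? q)) (λ _ → proj₁) xa (λ a∉q → proj₂ a∉q a∈q) k)

    rooted? : ∀ k → Dec (Rooted X k)
    rooted? zero = no Poly.⊥-elim
    rooted? (suc k) = any? λ s → rooted-at s (SourceIn? X? s)
      where
      rooted-at : ∀ s → Dec (SourceIn D X s) → Dec (SourceIn D X s × DtdLE D (Rest X s) k)
      rooted-at s (no ¬src) = no (¬src ∘ proj₁)
      rooted-at s (yes src) =
        map′ (src ,_) proj₂ (rec (Rest? X? s) (λ _ → proj₁) (proj₁ src) (λ s∈Y → proj₂ s∈Y ε) k)

  dtdLE? : ∀ {X} → Decidable X → ∀ k → Dec (DtdLE D X k)
  dtdLE? = shrinking-induction (λ {X} _ → ∀ k → Dec (DtdLE D X k)) λ X? rec k →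
    map′ view⇒dtdLE (dtdLE⇒view X?)
      (all? (∁? X?) ⊎-dec anySubset? (split? X? rec k) ⊎-dec rooted? X? rec k)

  module _ (dag : IsDAG D) where

    sourceIn-exists : ∀ {X} → Decidable X → Satisfiable X → ∃ (SourceIn D X)
    sourceIn-exists = shrinking-induction (λ {X} _ → Satisfiable X → ∃ (SourceIn D X)) step
      where
      step : ∀ {X} (X? : Decidable X) →
             ForProperSubsets (λ {Y} _ → Satisfiable Y → ∃ (SourceIn D Y)) X? →
             Satisfiable X → ∃ (SourceIn D X)
      step {X} X? rec (v , xv) with any? (λ u → ArcIn? X? u v)
      ... | no no-arc = v , xv , λ u a → no-arc (u , a)
      ... | yes (u , a) =
        ancestor-source (rec ancestors? (λ _ → proj₁) xv (no-cycle ∘ proj₂) (u , proj₁ a , ε))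
        where
        ancestors? : Decidable (X ∩ λ w → ReachIn D X w u)
        ancestors? = X? ∩? λ w → reachIn? X? w u
        no-cycle : ¬ ReachIn D X v u
        no-cycle = dag u v (proj₂ (proj₂ a)) ∘ reachIn⇒reach
        ancestor-source : ∃ (SourceIn D (X ∩ λ w → ReachIn D X w u)) → ∃ (SourceIn D X)
        ancestor-source (s , (xs , s⇝u) , no-arc) =
          s , xs , λ w (xw , _ , a′) → no-arc w ((xw , (xw , xs , a′) ◅ s⇝u) , (xs , s⇝u) , a′)

    dtdLE-exists : ∀ {X} → Decidable X → ∃ (DtdLE D X)
    dtdLE-exists = shrinking-induction (λ {X} _ → ∃ (DtdLE D X)) step
      where
      step : ∀ {X} (X? : Decidable X) → ForProperSubsets (λ {Y} _ → ∃ (DtdLE D Y)) X? →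
             ∃ (DtdLE D X)
      step X? rec with any? X?
      ... | no ¬x = 0 , dtd-empty λ v x → ¬x (v , x)
      ... | yes x with sourceIn-exists X? x
      ...   | s , src with rec (Rest? X? s) (λ _ → proj₁) (proj₁ src) (λ s∈Y → proj₂ s∈Y ε)
      ...     | k , T = suc k , dtd-root s src T

  -- Contraction graphs

  -- Unlike ValidChoice, this also constrains π on sources, forcing π s = s there.
  ChoiceOn : VSet n → (Fin n → Fin n) → Set
  ChoiceOn X π = ∀ v → X v → Source D (π v) × Reach D (π v) v

  -- ContractAdj D π with the witnessing vertex confined to X; which endpoints are
  -- sources is left to the vertex set the graph is considered on.
  ContractIn : VSet n → (Fin n → Fin n) → Fin n → Fin n → Set
  ContractIn X π s s′ =
    ¬ s ≡ s′ × Σ (Fin n) λ v → X v × ¬ Source D v ×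
      ((π v ≡ s × Reach D s′ v) ⊎ (π v ≡ s′ × Reach D s v))

  ContractionTdLE : VSet n → ℕ → Set₁
  ContractionTdLE X k =
    Σ (Fin n → Fin n) λ π → ChoiceOn X π × TdLE (ContractIn X π) (X ∩ Source D) k

  choice-glue : ∀ {X P : VSet n} {f g} (P? : Decidable P) →
                ChoiceOn (X ∩ P) f → ChoiceOn (X ∖ P) g → ChoiceOn X (glue P? f g)
  choice-glue P? cf cg v xv with P? v
  ... | yes p = cf v (xv , p)
  ... | no ¬p = cg v (xv , ¬p)

  module _ {π : Fin n → Fin n} where

    choice-antitone : ∀ {X Y} → X ⊆′ Y → ChoiceOn Y π → ChoiceOn X π
    choice-antitone X⊆Y c v = c v ∘ X⊆Y v

    choice-fixes-sources : ∀ {X s} → ChoiceOn X π → X s → Source D s → π s ≡ s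
    choice-fixes-sources c xs src = reach-source src (proj₂ (c _ xs))

    choice-lands : ∀ {X v} → Ancestral X → ChoiceOn X π → X v → (X ∩ Source D) (π v)
    choice-lands anc c xv = ancestral-reach anc (proj₂ (c _ xv)) xv , proj₁ (c _ xv)

    choice-ancestral : ∀ {X A v} → Ancestral A → ChoiceOn X π → X v → A v → A (π v)
    choice-ancestral anc c xv = ancestral-reach anc (proj₂ (c _ xv))

    contractIn-sym : ∀ {X s s′} → ContractIn X π s s′ → ContractIn X π s′ s
    contractIn-sym (s≢s′ , v , xv , nsv , w) = s≢s′ ∘ sym , v , xv , nsv , Sum.swap w

    contractIn-mono : ∀ {X Y s s′} → X ⊆′ Y → ContractIn X π s s′ → ContractIn Y π s s′
    contractIn-mono X⊆Y (s≢s′ , v , xv , rest) = s≢s′ , v , X⊆Y v xv , rest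

    arc⇒contractIn : ∀ {X u v} → ChoiceOn X π → X u → X v → Arc D u v → ¬ π u ≡ π v →
                     ContractIn X π (π u) (π v)
    arc⇒contractIn c xu xv a ne =
      ne , _ , xv , (λ src → src _ a) , inj₂ (refl , proj₂ (c _ xu) ◅◅ (a ◅ ε))

    contractIn-restrict : ∀ {X Q πQ s s′} →
                          (∀ {v} → X v → Q (π v) → Q v) → (∀ {v} → Q v → π v ≡ πQ v) →
                          Q s → Q s′ → ContractIn X π s s′ → ContractIn Q πQ s s′
    contractIn-restrict {Q = Q} reflect agree qs qs′ (s≢s′ , v , xv , nsv , w) =
      s≢s′ , v , owner-in w , nsv , Sum.map (retarget (owner-in w)) (retarget (owner-in w)) w
      where
      owner-in : (π v ≡ _ × _) ⊎ (π v ≡ _ × _) → Q v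
      owner-in (inj₁ (refl , _)) = reflect xv qs
      owner-in (inj₂ (refl , _)) = reflect xv qs′
      retarget : ∀ {t} {R : Set} → Q v → π v ≡ t × R → _ ≡ t × R
      retarget qv = Product.map₁ (trans (sym (agree qv)))

    preimage-separated : ∀ {X A B} → ChoiceOn X π → (∀ v → A v → ¬ B v) →
                         (∀ s s′ → A s → B s′ → ¬ ContractIn X π s s′) →
                         Separated (X ∩ (A ∘ π)) (X ∩ (B ∘ π))
    preimage-separated {A = A} c dis no-edge u w (xu , au) (xw , bw) =
        (λ a → no-edge _ _ au bw (arc⇒contractIn c xu xw a owners-differ))
      , (λ a → no-edge _ _ au bw (contractIn-sym (arc⇒contractIn c xw xu a (owners-differ ∘ sym))))
      where
      owners-differ : ¬ π u ≡ π w
      owners-differ e = dis _ (subst A e au) bw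

    preimage-sources : ∀ {X P : VSet n} → ChoiceOn X π → P ⊆′ X ∩ Source D →
                       P ≐′ (X ∩ (P ∘ π)) ∩ Source D
    preimage-sources {P = P} c P⊆ =
        (λ v pv → let (xv , sv) = P⊆ v pv in
                  (xv , subst P (sym (choice-fixes-sources c xv sv)) pv) , sv)
      , (λ v ((xv , pπv) , sv) → subst P (choice-fixes-sources c xv sv) pπv)

  contraction-split : ∀ {X A B k} → Decidable A → Decidable B →
                      (∀ v → X v → A v ⊎ B v) → A ⊆′ X → B ⊆′ X → (∀ v → A v → ¬ B v) →
                      Ancestral A → Ancestral B →
                      ContractionTdLE A k → ContractionTdLE B k → ContractionTdLE X k
  contraction-split {X} {A} {B} A? B? part sa sb dis ancA ancB (πA , cA , TA) (πB , cB , TB) =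
    π , choice ,
    tdLE-join (A? ∩? Source?) (B? ∩? Source?)
      (λ v (xv , sv) → Sum.map (_, sv) (_, sv) (part v xv))
      (λ v → Product.map₁ (sa v)) (λ v → Product.map₁ (sb v))
      (λ v (av , _) (bv , _) → dis v av bv)
      (λ _ _ (as , _) (bs′ , _) → no-crossing as bs′)
      (tdLE-mono ≐′-refl (λ _ _ (as , _) (as′ , _) →
        contractIn-restrict in-A (glue-in A? πA πB) as as′) TA)
      (tdLE-mono ≐′-refl (λ _ _ (bs , _) (bs′ , _) →
        contractIn-restrict in-B (glue-out A? πA πB ∘ flip (dis _)) bs bs′) TB)
    where
    π = glue A? πA πB

    choice : ChoiceOn X π
    choice = choice-glue A? (choice-antitone (λ _ → proj₂) cA)
                            (choice-antitone (λ v (xv , ¬av) → [ ⊥-elim ∘ ¬av , id ]′ (part v xv)) cB)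

    in-A : ∀ {v} → X v → A (π v) → A v
    in-A xv aπ with part _ xv
    ... | inj₁ av = av
    ... | inj₂ bv = ⊥-elim (dis _ aπ (choice-ancestral ancB choice xv bv))

    in-B : ∀ {v} → X v → B (π v) → B v
    in-B xv bπ with part _ xv
    ... | inj₁ av = ⊥-elim (dis _ (choice-ancestral ancA choice xv av) bπ)
    ... | inj₂ bv = bv

    reached-from-both : ∀ {a b v} → X v → Reach D a v → Reach D b v → A a → B b → ⊥
    reached-from-both xv a⇝v b⇝v aa bb with part _ xv
    ... | inj₁ av = dis _ (ancestral-reach ancA b⇝v av) bb
    ... | inj₂ bv = dis _ aa (ancestral-reach ancB a⇝v bv)

    no-crossing : ∀ {s s′} → A s → B s′ → ¬ ContractIn X π s s′
    no-crossing as bs′ (_ , v , xv , _ , inj₁ (refl , s′⇝v)) =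
      reached-from-both xv (proj₂ (choice v xv)) s′⇝v as bs′
    no-crossing as bs′ (_ , v , xv , _ , inj₂ (refl , s⇝v)) =
      reached-from-both xv s⇝v (proj₂ (choice v xv)) as bs′

  contraction-root : ∀ {X s k} → Decidable X → Ancestral X → SourceIn D X s →
                     ContractionTdLE (Rest X s) k → ContractionTdLE X (suc k)
  contraction-root {X} {s} X? anc (xs , no-arc) (πY , cY , TY) =
    π , choice ,
    td-root s (xs , source)
      (tdLE-mono rest-sources
        (λ u w yu yw → contractIn-restrict reflect (glue-out (reachIn? X? s) (const s) πY ∘ proj₂)
                         (proj₁ (proj₂ rest-sources u yu)) (proj₁ (proj₂ rest-sources w yw))) TY)
    where
    source : Source D s
    source u a = no-arc u (anc u s a xs , xs , a)

    π = glue (reachIn? X? s) (const s) πY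

    choice : ChoiceOn X π
    choice = choice-glue (reachIn? X? s) (λ v (_ , s⇝v) → source , reachIn⇒reach s⇝v) cY

    reflect : ∀ {v} → X v → Rest X s (π v) → Rest X s v
    reflect {v} xv rπ with reachIn? X? s v
    ... | yes _ = ⊥-elim (proj₂ rπ ε)
    ... | no ¬s⇝v = xv , ¬s⇝v

  dtdLE⇒contractionTdLE : ∀ {X k} → Decidable X → Ancestral X → DtdLE D X k → ContractionTdLE X k
  dtdLE⇒contractionTdLE X? anc (dtd-empty e) =
    id , (λ v → ⊥-elim ∘ e v) , td-empty λ v → e v ∘ proj₁
  dtdLE⇒contractionTdLE X? anc (dtd-split A B part sa sb dis _ _ sep DA DB) =
    contraction-split A? B? part sa sb dis ancA ancB
      (dtdLE⇒contractionTdLE A? ancA DA) (dtdLE⇒contractionTdLE B? ancB DB)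
    where
    part′ = λ v → Sum.swap ∘ part v
    A? = part? X? part sa dis
    B? = part? X? part′ sb (λ v b a → dis v a b)
    ancA = separated-ancestral anc part sa sep
    ancB = separated-ancestral anc part′ sb (separated-sym sep)
  dtdLE⇒contractionTdLE X? anc (dtd-root s src DY) =
    contraction-root X? anc src (dtdLE⇒contractionTdLE (Rest? X? s) (rest-ancestral anc) DY)

  contraction⇒dtdLE : ∀ {Adj : Fin n → Fin n → Set} {X Z π k} → Ancestral X → ChoiceOn X π →
                      Z ≐′ X ∩ Source D → (∀ s s′ → Z s → Z s′ → ContractIn X π s s′ → Adj s s′) →
                      TdLE Adj Z k → DtdLE D X k
  contraction⇒dtdLE anc c (_ , ⊆Z) edges (td-empty e) =
    dtd-empty λ v → e _ ∘ ⊆Z _ ∘ choice-lands anc c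
  contraction⇒dtdLE anc c (Z⊆ , ⊆Z) edges (td-root r zr T) =
    dtd-root r (uncurry source⇒sourceIn (Z⊆ r zr))
      (contraction⇒dtdLE (rest-ancestral anc) (choice-antitone (λ _ → proj₁) c)
        (≐′-trans ((λ u → Product.map₁ (Z⊆ u)) , (λ u → Product.map₁ (⊆Z u))) (≐′-sym rest-sources))
        (λ s s′ zs zs′ → edges s s′ (proj₁ zs) (proj₁ zs′) ∘ contractIn-mono (λ _ → proj₁)) T)
  contraction⇒dtdLE {Adj} {X} {Z} {π} anc c (Z⊆ , ⊆Z) edges
                    (td-split A B part sa sb dis (a , aa) (b , bb) noe TA TB) =
    dtd-split (X ∩ (A ∘ π)) (X ∩ (B ∘ π)) part′ (λ _ → proj₁) (λ _ → proj₁)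
      (λ v (_ , aπ) (_ , bπ) → dis _ aπ bπ)
      (a , proj₁ (proj₁ A≐ a aa)) (b , proj₁ (proj₁ B≐ b bb)) sep
      (contraction⇒dtdLE ancA (choice-antitone (λ _ → proj₁) c) A≐ (edges-within sa) TA)
      (contraction⇒dtdLE ancB (choice-antitone (λ _ → proj₁) c) B≐ (edges-within sb) TB)
    where
    part′ : ∀ v → X v → (X ∩ (A ∘ π)) v ⊎ (X ∩ (B ∘ π)) v
    part′ v xv = Sum.map (xv ,_) (xv ,_) (part _ (⊆Z _ (choice-lands anc c xv)))
    A≐ = preimage-sources c (λ v → Z⊆ v ∘ sa v)
    B≐ = preimage-sources c (λ v → Z⊆ v ∘ sb v)
    sep = preimage-separated c dis λ s s′ as bs′ →
            noe s s′ as bs′ ∘ edges s s′ (sa s as) (sb s′ bs′)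
    ancA = separated-ancestral anc part′ (λ _ → proj₁) sep
    ancB = separated-ancestral anc (λ v → Sum.swap ∘ part′ v) (λ _ → proj₁) (separated-sym sep)
    edges-within : ∀ {P} → P ⊆′ Z →
                   ∀ s s′ → P s → P s′ → ContractIn (X ∩ (P ∘ π)) π s s′ → Adj s s′
    edges-within P⊆Z s s′ ps ps′ =
      edges s s′ (P⊆Z s ps) (P⊆Z s′ ps′) ∘ contractIn-mono (λ _ → proj₁)

mainTheorem7 : (n : ℕ) (D : Digraph n) → IsDAG D →
    Σ (Fin n → Fin n) λ π₁ → Σ (Fin n → Fin n) λ π₂ →
    Σ ℕ λ t₁ → Σ ℕ λ d → Σ ℕ λ t₂ →
    ValidChoice D π₁ × ValidChoice D π₂ ×
    IsTd (ContractAdj D π₁) (SourceSet D) t₁ ×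
    IsDtd D d ×
    IsTd (ContractAdj D π₂) (SourceSet D) t₂ ×
    t₁ ≤ d × d ≤ t₂
mainTheorem7 n D dag
  with d , forest , minimal ← least (dtdLE? D (AllV? D)) (proj₂ (dtdLE-exists D dag (AllV? D)))
  with π , choice , tdπ ← dtdLE⇒contractionTdLE D (AllV? D) (λ _ _ _ _ → tt) forest
  = π , π , d , d , d , valid , valid , td-is-d , (forest , minimal) , td-is-d , ≤-refl , ≤-refl
  where
  valid : ValidChoice D π
  valid v _ = choice v tt

  sources≐ : AllV D ∩ Source D ≐′ SourceSet D
  sources≐ = (λ _ → proj₂) , (λ _ → tt ,_)

  to-ContractAdj : ∀ s s′ → Source D s → Source D s′ →
                   ContractIn D (AllV D) π s s′ → ContractAdj D π s s′
  to-ContractAdj _ _ s s′ (s≢s′ , v , _ , w) = s , s′ , s≢s′ , v , w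

  from-ContractAdj : ∀ s s′ → Source D s → Source D s′ →
                     ContractAdj D π s s′ → ContractIn D (AllV D) π s s′
  from-ContractAdj _ _ _ _ (_ , _ , s≢s′ , v , w) = s≢s′ , v , tt , w

  td-is-d : IsTd (ContractAdj D π) (SourceSet D) d
  td-is-d = tdLE-mono sources≐ from-ContractAdj tdπ
          , λ k T → minimal k (contraction⇒dtdLE D (λ _ _ _ _ → tt) choice
                                                  (≐′-sym sources≐) to-ContractAdj T)
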